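{- Let $n,m$ be positive integers. The set $\mathcal{S}_1(n,m)$ of $1$-foldable words of length $2n$ over the alphabet $\{A_1,\overline{A}_1,\dots,A_m,\overline{A}_m\}$ is in bijection with the set of pairs $(T,c)$ where $T$ is a plane tree with $n$ edges and $c:E(T)\to\{1,\dots,2m\}$ is a proper edge-coloring (edges sharing a vertex receive distinct colors).
   Context: $A_i$ and $\overline{A}_i$ are called complements. A plane tree is a rooted tree embedded in the plane with the root on top, so children of each vertex are ordered left to right. Its half edges are ordered by starting at the root and tracing the perimeter counterclockwise, touching each side of each edge exactly once. For a word $w=w[1]\cdots w[2n]$ and a plane tree $T$ with $n$ edges, label the $i$-th half edge by $w[i]$; $T$ is $w$-valid if for each edge the two letters labeling it are complements. A word $w$ is $k$-foldable if there are exactly $k$ plane trees that are $w$-valid. -}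

module Defs where

open import Data.Nat using (ℕ; zero; suc; _+_; _*_)
open import Data.Fin using (Fin)
open import Data.Bool using (Bool; not)
open import Data.Product using (Σ; _×_; _,_; proj₁; proj₂)
open import Data.Sum using (_⊎_; inj₁; inj₂)
open import Data.Unit using (⊤; tt)
open import Data.Empty using (⊥)
open import Data.List using (List; []; _∷_; _++_; length; map; zip; lookup)
open import Data.Vec as Vec using (Vec; toList)
open import Relation.Binary.PropositionalEquality using (_≡_; _≢_; subst)

-- Alphabet {A_1, Ā_1, …, A_m, Ā_m}:  (i , false) = A_{i+1},  (i , true) = Ā_{i+1}

Letter : ℕ → Set
Letter m = Fin m × Bool

Complement : ∀ {m} → Letter m → Letter m → Set
Complement (i , b) (j , b') = (i ≡ j) × (b' ≡ not b)

-- Plane trees: a vertex with an ordered (left-to-right) list of subtrees.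

data Tree : Set where
  node : List Tree → Tree

mutual
  numEdges : Tree → ℕ
  numEdges (node cs) = numEdgesF cs

  numEdgesF : List Tree → ℕ
  numEdgesF [] = 0
  numEdgesF (t ∷ ts) = suc (numEdges t) + numEdgesF ts

-- Vertices of a tree: inj₁ tt is the root, inj₂ v lies in a child subtree.
mutual
  Vertex : Tree → Set
  Vertex (node cs) = ⊤ ⊎ VertexF cs

  VertexF : List Tree → Set
  VertexF [] = ⊥
  VertexF (t ∷ ts) = Vertex t ⊎ VertexF ts

rootV : (t : Tree) → Vertex t
rootV (node cs) = inj₁ tt

-- For children list (t ∷ ts):
--   inj₁ (inj₁ tt) : the edge from the parent to the root of t
--   inj₁ (inj₂ e)  : an edge inside t
--   inj₂ e         : an edge among the later children ts
mutual
  Edge : Tree → Set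
  Edge (node cs) = EdgeF cs

  EdgeF : List Tree → Set
  EdgeF [] = ⊥
  EdgeF (t ∷ ts) = (⊤ ⊎ Edge t) ⊎ EdgeF ts

shiftV : ∀ {t ts} → ⊤ ⊎ VertexF ts → ⊤ ⊎ VertexF (t ∷ ts)
shiftV (inj₁ x) = inj₁ x
shiftV (inj₂ v) = inj₂ (inj₂ v)

mutual
  upper : (t : Tree) → Edge t → Vertex t
  upper (node cs) e = upperF cs e

  upperF : (cs : List Tree) → EdgeF cs → ⊤ ⊎ VertexF cs
  upperF (t ∷ ts) (inj₁ (inj₁ _)) = inj₁ tt
  upperF (t ∷ ts) (inj₁ (inj₂ e)) = inj₂ (inj₁ (upper t e))
  upperF (t ∷ ts) (inj₂ e) = shiftV (upperF ts e)

mutual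
  lower : (t : Tree) → Edge t → Vertex t
  lower (node cs) e = lowerF cs e

  lowerF : (cs : List Tree) → EdgeF cs → ⊤ ⊎ VertexF cs
  lowerF (t ∷ ts) (inj₁ (inj₁ _)) = inj₂ (inj₁ (rootV t))
  lowerF (t ∷ ts) (inj₁ (inj₂ e)) = inj₂ (inj₁ (lower t e))
  lowerF (t ∷ ts) (inj₂ e) = shiftV (lowerF ts e)

ShareVertex : (t : Tree) → Edge t → Edge t → Set
ShareVertex t e f =
  (upper t e ≡ upper t f) ⊎ (upper t e ≡ lower t f) ⊎
  (lower t e ≡ upper t f) ⊎ (lower t e ≡ lower t f)

-- Half edges in order: start at the root and trace the perimeter
-- counterclockwise (root on top, so the leftmost subtree is visited first).
-- Each edge occurs exactly twice (once for each of its sides).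

mutual
  tour : (t : Tree) → List (Edge t)
  tour (node cs) = tourF cs

  tourF : (cs : List Tree) → List (EdgeF cs)
  tourF [] = []
  tourF (t ∷ ts) =
    inj₁ (inj₁ tt) ∷ map (λ e → inj₁ (inj₂ e)) (tour t)
      ++ (inj₁ (inj₁ tt) ∷ map inj₂ (tourF ts))

-- T (with n edges) is w-valid: label the i-th half edge by w[i]; the two
-- letters on each edge are complements.
WValid : ∀ {m} n → Vec (Letter m) (2 * n) → Tree → Set
WValid {m} n w T =
  (numEdges T ≡ n) ×
  Σ (length (tour T) ≡ length (toList w)) λ _ →
    let ℓ = zip (tour T) (toList w) in
    ∀ i j → i ≢ j → proj₁ (lookup ℓ i) ≡ proj₁ (lookup ℓ j) →
      Complement (proj₂ (lookup ℓ i)) (proj₂ (lookup ℓ j))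

Foldable : ∀ {m} n → ℕ → Vec (Letter m) (2 * n) → Set
Foldable n k w =
  Σ (Vec Tree k) λ ts →
    (∀ i j → Vec.lookup ts i ≡ Vec.lookup ts j → i ≡ j) ×
    (∀ i → WValid n w (Vec.lookup ts i)) ×
    (∀ T → WValid n w T → Σ (Fin k) λ i → Vec.lookup ts i ≡ T)

record FoldWord (n m : ℕ) : Set where
  constructor fword
  field
    word     : Vec (Letter m) (2 * n)
    foldable : Foldable n 1 word

_≈W_ : ∀ {n m} → FoldWord n m → FoldWord n m → Set
x ≈W y = FoldWord.word x ≡ FoldWord.word y

record ColoredTree (n m : ℕ) : Set where
  constructor ctree
  field
    tree   : Tree
    edges  : numEdges tree ≡ n
    color  : Edge tree → Fin (2 * m)
    proper : ∀ e f → e ≢ f → ShareVertex tree e f → color e ≢ color f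

_≈C_ : ∀ {n m} → ColoredTree n m → ColoredTree n m → Set
x ≈C y = Σ (ColoredTree.tree x ≡ ColoredTree.tree y) λ p →
  ∀ e → ColoredTree.color x e ≡ ColoredTree.color y (subst Edge p e)

Bijection : ℕ → ℕ → Set
Bijection n m =
  Σ (FoldWord n m → ColoredTree n m) λ to →
  Σ (ColoredTree n m → FoldWord n m) λ from →
    (∀ x → from (to x) ≈W x) × (∀ y → to (from y) ≈C y)

-- A w-valid plane tree is the same as a tree T with a labelling ℓ of its edges by letters such that w is
-- the word of (T, ℓ): on the tour, an edge labelled x is read as x on the way down and as x̄ on the way
-- up. Call ℓ rainbow when, at every vertex, the edges to the children carry distinct letters, none of
-- them the complement of the letter on the edge from the parent. If ℓ is rainbow, reducing w freely
-- with a stack recovers T (every letter pushes or pops exactly as T dictates), so w is 1-foldable; if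
-- ℓ is not rainbow, a repeated sibling letter or a letter x̄ below x lets T be refolded into another
-- w-valid tree. Finally, rainbow labellings are in bijection with proper colourings by {1,…,2m}:
-- letters are turned into colours through a bijection that is adjusted at every vertex so that the
-- complement of the parent's letter receives the parent's colour.

module Submission where

open import Defs
open import Data.Bool as Bool using (Bool; not)
open import Data.Bool.Properties using (not-involutive)
open import Data.Empty using (⊥-elim)
open import Data.Fin as Fin using (Fin)
open import Data.Fin.Permutation using (transpose)
import Data.Fin.Permutation.Components as PC
open import Data.Fin.Properties using (*↔×; 2↔Bool)
open import Data.List using (List; []; _∷_; _++_; length; map; zip; lookup; head; foldl)
open import Data.List.Membership.Propositional using (_∈_; _∉_)
open import Data.List.Membership.Propositional.Properties using (∈-lookup; ∈-map⁺; ∈-map⁻)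
open import Data.List.Properties
  using ( length-++; length-++-sucʳ; length-map; ∷-injective; ∷-injectiveˡ; ∷-injectiveʳ; ++-assoc
        ; tabulate-lookup; foldl-++)
open import Data.List.Relation.Unary.All as All using ([]; _∷_)
import Data.List.Relation.Unary.All.Properties as All
open import Data.List.Relation.Unary.AllPairs as AllPairs using (AllPairs; []; _∷_)
import Data.List.Relation.Unary.AllPairs.Properties as AllPairs
open import Data.List.Relation.Unary.Any using (here; there)
open import Data.Maybe as Maybe using (Maybe; just; nothing)
open import Data.Maybe.Properties using (just-injective) renaming (≡-dec to maybe-≡-dec)
open import Data.Nat using (ℕ; suc; _+_; _*_; _≥_)
open import Data.Nat.Properties using (suc-injective; m≢1+n+m; m≢1+m+n; *-cancelˡ-≡)
open import Data.Nat.Tactic.RingSolver using (solve-∀)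
open import Data.Product using (∃-syntax; _×_; _,_; proj₁; proj₂; map₁)
open import Data.Product.Algebra using (×-cong; ×-comm)
open import Data.Product.Properties using () renaming (≡-dec to ×-≡-dec)
open import Data.Sum as Sum using (_⊎_; inj₁; inj₂)
open import Data.Unit using (⊤; tt)
open import Data.Vec as Vec using (Vec; toList)
open import Data.Vec.Properties using (toList-injective; toList-cast; toList∘fromList)
open import Data.Vec.Relation.Binary.Equality.Cast using (cast-is-id)
open import Function using (_∘_; id; _↔_; Inverse; Injection)
open import Function.Properties.Inverse using (↔-sym; ↔-trans; ↔-refl; ↔⇒↣)
open import Relation.Binary.Definitions using (DecidableEquality)
open import Relation.Binary.PropositionalEquality
open import Relation.Nullary using (¬_; yes; no)
open import Relation.Nullary.Decidable using (dec-true)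

open Inverse using (to; from; strictlyInverseˡ; strictlyInverseʳ)

pattern trunk   = inj₁ (inj₁ tt)
pattern inner e = inj₁ (inj₂ e)
pattern rest e  = inj₂ e

private
  variable
    A B : Set

zip-map₁ : ∀ {C : Set} (f : A → C) (xs : List A) (ys : List B) →
           zip (map f xs) ys ≡ map (map₁ f) (zip xs ys)
zip-map₁ f []       ys       = refl
zip-map₁ f (x ∷ xs) []       = refl
zip-map₁ f (x ∷ xs) (y ∷ ys) = cong ((f x , y) ∷_) (zip-map₁ f xs ys)

zip-++ : ∀ (xs : List A) (ys : List B) {xs′ ys′} → length xs ≡ length ys →
         zip (xs ++ xs′) (ys ++ ys′) ≡ zip xs ys ++ zip xs′ ys′
zip-++ []       []       eq = refl
zip-++ (x ∷ xs) (y ∷ ys) eq = cong ((x , y) ∷_) (zip-++ xs ys (suc-injective eq))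

split-like : ∀ (xs : List A) {y ys} (ws : List B) → length (xs ++ y ∷ ys) ≡ length ws →
             ∃[ w₁ ] ∃[ b ] ∃[ w₂ ] (ws ≡ w₁ ++ b ∷ w₂) ×
               (length xs ≡ length w₁) × (length ys ≡ length w₂)
split-like []       (b ∷ ws) eq = [] , b , ws , refl , refl , suc-injective eq
split-like (x ∷ xs) (w ∷ ws) eq with split-like xs ws (suc-injective eq)
... | w₁ , b , w₂ , refl , eq₁ , eq₂ = w ∷ w₁ , b , w₂ , refl , cong suc eq₁ , eq₂

++-injective : ∀ (xs ys : List A) {xs′ ys′} → length xs ≡ length ys → xs ++ xs′ ≡ ys ++ ys′ →
               xs ≡ ys × xs′ ≡ ys′
++-injective []       []       _   eq = refl , eq
++-injective (x ∷ xs) (y ∷ ys) len eq with refl , eq′ ← ∷-injective eq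
  with refl , eq″ ← ++-injective xs ys (suc-injective len) eq′ = refl , eq″

++-∷-≢ʳ : ∀ (xs : List A) {y} ys → xs ++ y ∷ ys ≢ ys
++-∷-≢ʳ xs {y} ys eq =
  m≢1+n+m (length ys) (trans (cong length (sym eq)) (trans (length-++-sucʳ xs y ys) (cong suc (length-++ xs))))

length-++-∷-≢ : ∀ (xs : List A) {y ys} → length (xs ++ y ∷ ys) ≢ length xs
length-++-∷-≢ xs {y} {ys} eq =
  m≢1+m+n (length xs) (trans (sym eq) (trans (length-++-sucʳ xs y ys) (cong suc (length-++ xs))))

++-∷-≢ˡ : ∀ (xs : List A) {y ys} → xs ++ y ∷ ys ≢ xs
++-∷-≢ˡ xs = length-++-∷-≢ xs ∘ cong length

++-∷-++-∷-assoc : ∀ (xs : List A) {y} ys {z} zs ws →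
                  (xs ++ y ∷ ys ++ z ∷ zs) ++ ws ≡ xs ++ y ∷ ys ++ z ∷ zs ++ ws
++-∷-++-∷-assoc xs {y} ys {z} zs ws =
  trans (++-assoc xs (y ∷ ys ++ z ∷ zs) ws) (cong (λ u → xs ++ y ∷ u) (++-assoc ys (z ∷ zs) ws))

++-prefix-cases : ∀ (p r u : List A) {z v} → p ++ r ≡ u ++ z ∷ v →
  (∃[ r′ ] u ≡ p ++ r′) ⊎ (∃[ p′ ] p ≡ u ++ z ∷ p′ × p′ ++ r ≡ v)
++-prefix-cases []      r u       eq = inj₁ (u , refl)
++-prefix-cases (x ∷ p) r []      eq with refl , eq′ ← ∷-injective eq = inj₂ (p , refl , eq′)
++-prefix-cases (x ∷ p) r (y ∷ u) eq with refl , eq′ ← ∷-injective eq with ++-prefix-cases p r u eq′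
... | inj₁ (r′ , refl)      = inj₁ (r′ , refl)
... | inj₂ (p′ , refl , eq″) = inj₂ (p′ , refl , eq″)

++-∷-trichotomy : ∀ (a c : List A) {y z b d} → a ++ y ∷ b ≡ c ++ z ∷ d →
  (a ≡ c × b ≡ d) ⊎
  (∃[ r ] c ≡ a ++ y ∷ r × r ++ z ∷ d ≡ b) ⊎
  (∃[ r ] a ≡ c ++ z ∷ r × r ++ y ∷ b ≡ d)
++-∷-trichotomy []      []      eq = inj₁ (refl , ∷-injectiveʳ eq)
++-∷-trichotomy []      (_ ∷ c) eq with refl , eq′ ← ∷-injective eq = inj₂ (inj₁ (c , refl , sym eq′))
++-∷-trichotomy (_ ∷ a) []      eq with refl , eq′ ← ∷-injective eq = inj₂ (inj₂ (a , refl , eq′))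
++-∷-trichotomy (x ∷ a) (_ ∷ c) eq with refl , eq′ ← ∷-injective eq with ++-∷-trichotomy a c eq′
... | inj₁ (refl , eq″)             = inj₁ (refl , eq″)
... | inj₂ (inj₁ (r , refl , eq″)) = inj₂ (inj₁ (r , refl , eq″))
... | inj₂ (inj₂ (r , refl , eq″)) = inj₂ (inj₂ (r , refl , eq″))

length-∷-++-∷ : ∀ (xs ys : List A) {x y} a b → length xs ≡ 2 * a → length ys ≡ 2 * b →
                length (x ∷ xs ++ y ∷ ys) ≡ 2 * suc (a + b)
length-∷-++-∷ xs ys a b eqx eqy = begin
  suc (length (xs ++ _ ∷ ys))        ≡⟨ cong suc (length-++ xs) ⟩
  suc (length xs + suc (length ys))  ≡⟨ cong₂ (λ k l → suc (k + suc l)) eqx eqy ⟩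
  suc (2 * a + suc (2 * b))          ≡⟨ twice a b ⟩
  2 * suc (a + b)                    ∎
  where
  open ≡-Reasoning
  twice : ∀ a b → suc (2 * a + suc (2 * b)) ≡ 2 * suc (a + b)
  twice = solve-∀

module _ {R : A → A → Set} where

  allPairs-++⁻ˡ : ∀ xs {ys} → AllPairs R (xs ++ ys) → AllPairs R xs
  allPairs-++⁻ˡ []       _          = []
  allPairs-++⁻ˡ (x ∷ xs) (px ∷ pxs) = All.++⁻ˡ xs px ∷ allPairs-++⁻ˡ xs pxs

  allPairs-++⁻ʳ : ∀ xs {ys} → AllPairs R (xs ++ ys) → AllPairs R ys
  allPairs-++⁻ʳ []       pxs        = pxs
  allPairs-++⁻ʳ (x ∷ xs) (_ ∷ pxs) = allPairs-++⁻ʳ xs pxs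

  allPairs-lookup : (∀ {x y} → R x y → R y x) → ∀ {xs} → AllPairs R xs →
                    ∀ i j → i ≢ j → R (lookup xs i) (lookup xs j)
  allPairs-lookup sym {x ∷ xs} (px ∷ pxs) Fin.zero    Fin.zero    i≢j = ⊥-elim (i≢j refl)
  allPairs-lookup sym {x ∷ xs} (px ∷ pxs) Fin.zero    (Fin.suc j) _   = All.lookup px (∈-lookup j)
  allPairs-lookup sym {x ∷ xs} (px ∷ pxs) (Fin.suc i) Fin.zero    _   = sym (All.lookup px (∈-lookup i))
  allPairs-lookup sym {x ∷ xs} (px ∷ pxs) (Fin.suc i) (Fin.suc j) i≢j =
    allPairs-lookup sym pxs i j (i≢j ∘ cong Fin.suc)

  lookup⇒allPairs : ∀ xs → (∀ i j → i ≢ j → R (lookup xs i) (lookup xs j)) → AllPairs R xs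
  lookup⇒allPairs xs h = subst (AllPairs R) (tabulate-lookup xs) (AllPairs.tabulate⁺ (h _ _))

module _ {g : A → B} (g-injective : ∀ {x y} → g x ≡ g y → x ≡ y) where

  map-≢-just : ∀ {f x} → f ≢ just x → Maybe.map g f ≢ just (g x)
  map-≢-just {nothing} _   ()
  map-≢-just {just y}  y≢x eq = y≢x (cong just (g-injective (just-injective eq)))

  ∈-map-injective : ∀ {x xs} → g x ∈ map g xs → x ∈ xs
  ∈-map-injective gx∈ with y , y∈ , gx≡gy ← ∈-map⁻ g gx∈ =
    subst (_∈ _) (sym (g-injective gx≡gy)) y∈

to-injective : (σ : A ↔ B) → ∀ {x y} → to σ x ≡ to σ y → x ≡ y
to-injective σ = Injection.injective (↔⇒↣ σ)

toList-injective-≡ : ∀ {k} (xs ys : Vec A k) → toList xs ≡ toList ys → xs ≡ ys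
toList-injective-≡ xs ys eq = trans (sym (cast-is-id refl xs)) (toList-injective refl xs ys eq)

length-tour : ∀ cs → length (tourF cs) ≡ 2 * numEdgesF cs
length-tour []             = refl
length-tour (node ct ∷ ts) =
  length-∷-++-∷ (map inner (tourF ct)) (map rest (tourF ts)) {trunk} {trunk} (numEdgesF ct) (numEdgesF ts)
  (trans (length-map inner (tourF ct)) (length-tour ct))
  (trans (length-map rest (tourF ts)) (length-tour ts))

zip-tour : ∀ ct ts {a b : B} w₁ w₂ → length (tourF ct) ≡ length w₁ →
  zip (tourF (node ct ∷ ts)) (a ∷ w₁ ++ b ∷ w₂) ≡
  (trunk , a) ∷ map (map₁ inner) (zip (tourF ct) w₁) ++ (trunk , b) ∷ map (map₁ rest) (zip (tourF ts) w₂)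
zip-tour ct ts {a} {b} w₁ w₂ eq = cong ((trunk , a) ∷_) (begin
  zip (map inner (tourF ct) ++ trunk ∷ map rest (tourF ts)) (w₁ ++ b ∷ w₂)
    ≡⟨ zip-++ (map inner (tourF ct)) w₁ (trans (length-map inner (tourF ct)) eq) ⟩
  zip (map inner (tourF ct)) w₁ ++ (trunk , b) ∷ zip (map rest (tourF ts)) w₂
    ≡⟨ cong₂ (λ u v → u ++ (trunk , b) ∷ v) (zip-map₁ inner (tourF ct) w₁)
                                              (zip-map₁ rest (tourF ts) w₂) ⟩
  map (map₁ inner) (zip (tourF ct) w₁) ++ (trunk , b) ∷ map (map₁ rest) (zip (tourF ts) w₂) ∎)
  where open ≡-Reasoning

node-injective : ∀ {cs cs′} → node cs ≡ node cs′ → cs ≡ cs′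
node-injective refl = refl

inner-injective : ∀ {ct ts} {e f : EdgeF ct} → _≡_ {A = EdgeF (node ct ∷ ts)} (inner e) (inner f) → e ≡ f
inner-injective refl = refl

rest-injective : ∀ {ct ts} {e f : EdgeF ts} → _≡_ {A = EdgeF (node ct ∷ ts)} (rest e) (rest f) → e ≡ f
rest-injective refl = refl

node-labelling : ∀ {ct ts} → A → (EdgeF ct → A) → (EdgeF ts → A) → EdgeF (node ct ∷ ts) → A
node-labelling x ℓ₁ ℓ₂ trunk     = x
node-labelling x ℓ₁ ℓ₂ (inner e) = ℓ₁ e
node-labelling x ℓ₁ ℓ₂ (rest e)  = ℓ₂ e

++-labelling : ∀ cs₁ {cs₂} → (EdgeF cs₁ → A) → (EdgeF cs₂ → A) → EdgeF (cs₁ ++ cs₂) → A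
++-labelling []              ℓ₁ ℓ₂ e         = ℓ₂ e
++-labelling (node ct ∷ cs₁) ℓ₁ ℓ₂ trunk     = ℓ₁ trunk
++-labelling (node ct ∷ cs₁) ℓ₁ ℓ₂ (inner e) = ℓ₁ (inner e)
++-labelling (node ct ∷ cs₁) ℓ₁ ℓ₂ (rest e)  = ++-labelling cs₁ (ℓ₁ ∘ rest) ℓ₂ e

trunks : (cs : List Tree) → (EdgeF cs → A) → List A
trunks []             ℓ = []
trunks (node ct ∷ ts) ℓ = ℓ trunk ∷ trunks ts (ℓ ∘ rest)

-- f is the value excluded at the roots of cs, h x the value excluded below an edge labelled x.
Rainbow : (A → A) → (cs : List Tree) → (EdgeF cs → A) → Maybe A → Set
Rainbow h []             ℓ f = ⊤
Rainbow h (node ct ∷ ts) ℓ f =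
  f ≢ just (ℓ trunk) × ℓ trunk ∉ trunks ts (ℓ ∘ rest) ×
  Rainbow h ct (ℓ ∘ inner) (just (h (ℓ trunk))) × Rainbow h ts (ℓ ∘ rest) f

rainbow-trunks : ∀ {h} cs {ℓ : EdgeF cs → A} {f} → Rainbow h cs ℓ f →
                 ∀ {y} → y ∈ trunks cs ℓ → f ≢ just y
rainbow-trunks (node ct ∷ ts) (fresh , _ , _ , _)   (here refl) = fresh
rainbow-trunks (node ct ∷ ts) (_ , _ , _ , rts) (there y∈) = rainbow-trunks ts rts y∈

-- Words and valid trees

module _ {m : ℕ} where

  complement : Letter m → Letter m
  complement (i , b) = i , not b

  complement-involutive : ∀ x → complement (complement x) ≡ x
  complement-involutive (i , b) = cong (i ,_) (not-involutive b)

  Complement-complement : ∀ x → Complement x (complement x)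
  Complement-complement x = refl , refl

  Complement⇒≡complement : ∀ {x y} → Complement x y → y ≡ complement x
  Complement⇒≡complement (refl , refl) = refl

  Complement-sym : ∀ {x y : Letter m} → Complement x y → Complement y x
  Complement-sym {_ , b} (refl , refl) = refl , sym (not-involutive b)

  word : (cs : List Tree) → (EdgeF cs → Letter m) → List (Letter m)
  word []             ℓ = []
  word (node ct ∷ ts) ℓ =
    ℓ trunk ∷ word ct (ℓ ∘ inner) ++ complement (ℓ trunk) ∷ word ts (ℓ ∘ rest)

  length-word : ∀ cs ℓ → length (word cs ℓ) ≡ 2 * numEdgesF cs
  length-word []             ℓ = refl
  length-word (node ct ∷ ts) ℓ =
    length-∷-++-∷ (word ct (ℓ ∘ inner)) (word ts (ℓ ∘ rest)) {ℓ trunk} (numEdgesF ct) (numEdgesF ts)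
      (length-word ct (ℓ ∘ inner)) (length-word ts (ℓ ∘ rest))

  length-tour-word : ∀ cs ℓ → length (tourF cs) ≡ length (word cs ℓ)
  length-tour-word cs ℓ = trans (length-tour cs) (sym (length-word cs ℓ))

  length-word-labelling : ∀ cs ℓ ℓ′ → length (word cs ℓ) ≡ length (word cs ℓ′)
  length-word-labelling cs ℓ ℓ′ = trans (length-word cs ℓ) (sym (length-word cs ℓ′))

  word-cong : ∀ cs {ℓ ℓ′} → (∀ e → ℓ e ≡ ℓ′ e) → word cs ℓ ≡ word cs ℓ′
  word-cong []             h = refl
  word-cong (node ct ∷ ts) h
    rewrite h trunk | word-cong ct (h ∘ inner) | word-cong ts (h ∘ rest) = refl

  word-injective : ∀ cs {ℓ ℓ′} → word cs ℓ ≡ word cs ℓ′ → ∀ e → ℓ e ≡ ℓ′ e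
  word-injective (node ct ∷ ts) {ℓ} {ℓ′} eq e
    with eqx , eq′ ← ∷-injective eq
    with eqct , eqts ← ++-injective (word ct (ℓ ∘ inner)) (word ct (ℓ′ ∘ inner))
                         (length-word-labelling ct (ℓ ∘ inner) (ℓ′ ∘ inner)) eq′
    with e
  ... | trunk   = eqx
  ... | inner f = word-injective ct eqct f
  ... | rest f  = word-injective ts (∷-injectiveʳ eqts) f

  word-++ : ∀ cs₁ {cs₂} ℓ₁ ℓ₂ →
            word (cs₁ ++ cs₂) (++-labelling cs₁ ℓ₁ ℓ₂) ≡ word cs₁ ℓ₁ ++ word cs₂ ℓ₂
  word-++ []              ℓ₁ ℓ₂ = refl
  word-++ (node ct ∷ cs₁) ℓ₁ ℓ₂ = cong (x ∷_) (begin
    word ct (ℓ₁ ∘ inner) ++ complement x ∷ word (cs₁ ++ _) (++-labelling cs₁ (ℓ₁ ∘ rest) ℓ₂)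
      ≡⟨ cong (λ u → word ct (ℓ₁ ∘ inner) ++ complement x ∷ u) (word-++ cs₁ (ℓ₁ ∘ rest) ℓ₂) ⟩
    word ct (ℓ₁ ∘ inner) ++ complement x ∷ word cs₁ (ℓ₁ ∘ rest) ++ word _ ℓ₂
      ≡⟨ ++-assoc (word ct (ℓ₁ ∘ inner)) (complement x ∷ word cs₁ (ℓ₁ ∘ rest)) (word _ ℓ₂) ⟨
    (word ct (ℓ₁ ∘ inner) ++ complement x ∷ word cs₁ (ℓ₁ ∘ rest)) ++ word _ ℓ₂ ∎)
    where
    open ≡-Reasoning
    x = ℓ₁ trunk

  numEdges-word : ∀ {cs cs′} {ℓ : EdgeF cs → Letter m} {ℓ′} →
                  word cs ℓ ≡ word cs′ ℓ′ → numEdgesF cs ≡ numEdgesF cs′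
  numEdges-word {cs} {cs′} {ℓ} {ℓ′} eq =
    *-cancelˡ-≡ _ _ 2 (trans (sym (length-word cs ℓ)) (trans (cong length eq) (length-word cs′ ℓ′)))

  -- WValid asks exactly this of every two distinct half edges of the tour.
  Matched : ∀ {E : Set} → E × Letter m → E × Letter m → Set
  Matched p q = proj₁ p ≡ proj₁ q → Complement (proj₂ p) (proj₂ q)

  Matched-sym : ∀ {E : Set} {p q : E × Letter m} → Matched p q → Matched q p
  Matched-sym h = Complement-sym ∘ h ∘ sym

  module _ {ct ts : List Tree} where

    matched-node⁺ : ∀ {a b} X₁ X₂ → Complement a b → AllPairs Matched X₁ → AllPairs Matched X₂ →
      AllPairs (Matched {EdgeF (node ct ∷ ts)})
               ((trunk , a) ∷ map (map₁ inner) X₁ ++ (trunk , b) ∷ map (map₁ rest) X₂)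
    matched-node⁺ X₁ X₂ c p₁ p₂ =
      All.++⁺ (All.map⁺ (All.universal (λ _ ()) X₁)) ((λ _ → c) ∷ All.map⁺ (All.universal (λ _ ()) X₂))
      ∷ AllPairs.++⁺ (AllPairs.map⁺ (AllPairs.map (_∘ inner-injective) p₁))
          (All.map⁺ (All.universal (λ _ ()) X₂) ∷ AllPairs.map⁺ (AllPairs.map (_∘ rest-injective) p₂))
          (All.map⁺ (All.universal (λ _ → (λ ()) ∷ All.map⁺ (All.universal (λ _ ()) X₂)) X₁))

    matched-node⁻ : ∀ {a b} X₁ X₂ →
      AllPairs (Matched {EdgeF (node ct ∷ ts)})
               ((trunk , a) ∷ map (map₁ inner) X₁ ++ (trunk , b) ∷ map (map₁ rest) X₂) →
      Complement a b × AllPairs Matched X₁ × AllPairs Matched X₂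
    matched-node⁻ X₁ X₂ (pa ∷ ps) =
        All.head (All.++⁻ʳ (map (map₁ inner) X₁) pa) refl
      , AllPairs.map (_∘ cong inner) (AllPairs.map⁻ (allPairs-++⁻ˡ _ ps))
      , AllPairs.map (_∘ cong rest)
          (AllPairs.map⁻ (AllPairs.tail (allPairs-++⁻ʳ (map (map₁ inner) X₁) ps)))

  word-matched : ∀ cs ℓ → AllPairs Matched (zip (tourF cs) (word cs ℓ))
  word-matched []             ℓ = []
  word-matched (node ct ∷ ts) ℓ =
    subst (AllPairs Matched)
      (sym (zip-tour ct ts (word ct (ℓ ∘ inner)) (word ts (ℓ ∘ rest)) (length-tour-word ct (ℓ ∘ inner))))
      (matched-node⁺ _ _ (Complement-complement (ℓ trunk))
        (word-matched ct (ℓ ∘ inner)) (word-matched ts (ℓ ∘ rest)))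

  matched-word : ∀ cs ws → length (tourF cs) ≡ length ws → AllPairs Matched (zip (tourF cs) ws) →
                 ∃[ ℓ ] ws ≡ word cs ℓ
  matched-word []             []       _  _  = (λ ()) , refl
  matched-word (node ct ∷ ts) (a ∷ ws) eq ps with split-like (map inner (tourF ct)) ws (suc-injective eq)
  ... | w₁ , b , w₂ , refl , eq₁ , eq₂ =
    matched-word-node (trans (sym (length-map inner (tourF ct))) eq₁)
                      (trans (sym (length-map rest (tourF ts))) eq₂) ps
    where
    matched-word-node : length (tourF ct) ≡ length w₁ → length (tourF ts) ≡ length w₂ →
      AllPairs Matched (zip (tourF (node ct ∷ ts)) (a ∷ w₁ ++ b ∷ w₂)) →
      ∃[ ℓ ] a ∷ w₁ ++ b ∷ w₂ ≡ word (node ct ∷ ts) ℓ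
    matched-word-node eq₁ eq₂ ps
      with c , p₁ , p₂ ← matched-node⁻ _ _ (subst (AllPairs Matched) (zip-tour ct ts w₁ w₂ eq₁) ps)
      with ℓ₁ , refl ← matched-word ct w₁ eq₁ p₁
      with ℓ₂ , refl ← matched-word ts w₂ eq₂ p₂
      = node-labelling a ℓ₁ ℓ₂ ,
        cong (λ b → a ∷ word ct ℓ₁ ++ b ∷ word ts ℓ₂) (Complement⇒≡complement c)

  valid⇒word : ∀ {n} (w : Vec (Letter m) (2 * n)) cs → WValid n w (node cs) →
               ∃[ ℓ ] toList w ≡ word cs ℓ
  valid⇒word w cs (_ , eq , h) = matched-word cs (toList w) eq (lookup⇒allPairs _ h)

  word⇒valid : ∀ {n} (w : Vec (Letter m) (2 * n)) cs ℓ → numEdgesF cs ≡ n → toList w ≡ word cs ℓ →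
               WValid n w (node cs)
  word⇒valid w cs ℓ edges eq =
    edges , trans (length-tour-word cs ℓ) (cong length (sym eq)) ,
    allPairs-lookup Matched-sym
      (subst (λ ws → AllPairs Matched (zip (tourF cs) ws)) (sym eq) (word-matched cs ℓ))

-- Free reduction

Above : List A → List A → List A → Set
Above T s s′ = s′ ≡ s ⊎ ∃[ δ ] ∃[ c ] s′ ≡ δ ++ c ∷ s × c ∈ T

above-∷ : ∀ {T T′ : List A} {x s s′} → Above T (x ∷ s) s′ → Above (x ∷ T′) s s′
above-∷ {x = x} (inj₁ refl)            = inj₂ ([] , x , refl , here refl)
above-∷ {x = x} {s} (inj₂ (δ , c , refl , _)) =
  inj₂ (δ ++ c ∷ [] , x , sym (++-assoc δ (c ∷ []) (x ∷ s)) , here refl)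

above-there : ∀ {T : List A} {x s s′} → Above T s s′ → Above (x ∷ T) s s′
above-there (inj₁ eq)                 = inj₁ eq
above-there (inj₂ (δ , c , eq , c∈)) = inj₂ (δ , c , eq , there c∈)

above-≢ : ∀ {T : List A} {x s s′} → Above T (x ∷ s) s′ → s′ ≢ s
above-≢ {s = s} (inj₁ refl)               = ++-∷-≢ʳ [] s
above-≢ {x = x} {s} (inj₂ (δ , c , refl , _)) =
  ++-∷-≢ʳ (δ ++ c ∷ []) s ∘ trans (++-assoc δ (c ∷ []) (x ∷ s))

above-head : ∀ {T : List A} {y s} → Above T s (y ∷ s) → y ∈ T
above-head {s = s} (inj₁ eq)                  = ⊥-elim (++-∷-≢ʳ [] s eq)
above-head (inj₂ ([] , c , eq , c∈))         = subst (_∈ _) (sym (∷-injectiveˡ eq)) c∈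
above-head {s = s} (inj₂ (_ ∷ δ , c , eq , _)) = ⊥-elim (++-∷-≢ʳ δ s (sym (∷-injectiveʳ eq)))

module _ {m : ℕ} where

  _≟_ : DecidableEquality (Letter m)
  _≟_ = ×-≡-dec Fin._≟_ Bool._≟_

  forbidden : List (Letter m) → Maybe (Letter m)
  forbidden s = Maybe.map complement (head s)

  push : List (Letter m) → Letter m → List (Letter m)
  push []      y = y ∷ []
  push (z ∷ s) y with y ≟ complement z
  ... | yes _ = s
  ... | no  _ = y ∷ z ∷ s

  reduce : List (Letter m) → List (Letter m) → List (Letter m)
  reduce = foldl push

  Reduced : List (Letter m) → Set
  Reduced []      = ⊤
  Reduced (y ∷ s) = forbidden s ≢ just y × Reduced s

  push-fresh : ∀ s {y} → forbidden s ≢ just y → push s y ≡ y ∷ s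
  push-fresh []      _     = refl
  push-fresh (z ∷ s) {y} fresh with y ≟ complement z
  ... | yes y≡z̄ = ⊥-elim (fresh (cong just (sym y≡z̄)))
  ... | no  _   = refl

  push-complement : ∀ x s → push (x ∷ s) (complement x) ≡ s
  push-complement x s with complement x ≟ complement x
  ... | yes _  = refl
  ... | no x̄≢x̄ = ⊥-elim (x̄≢x̄ refl)

  push-reduced : ∀ s y → Reduced s → Reduced (push s y)
  push-reduced []      y _ = (λ ()) , tt
  push-reduced (z ∷ s) y r with y ≟ complement z
  ... | yes _   = proj₂ r
  ... | no  y≢z̄ = (λ eq → y≢z̄ (sym (just-injective eq))) , r

  push-push-complement : ∀ s y → Reduced s → push (push s y) (complement y) ≡ s
  push-push-complement []      y _          = push-complement y []
  push-push-complement (z ∷ s) y (fresh , _) with y ≟ complement z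
  ... | yes refl = trans (cong (push s) (complement-involutive z)) (push-fresh s fresh)
  ... | no  _    = push-complement y (z ∷ s)

  reduce-word : ∀ s cs ℓ → Reduced s → reduce s (word cs ℓ) ≡ s
  reduce-word s []             ℓ _ = refl
  reduce-word s (node ct ∷ ts) ℓ r = begin
    reduce (push s x) (word ct (ℓ ∘ inner) ++ complement x ∷ word ts (ℓ ∘ rest))
      ≡⟨ foldl-++ push (push s x) (word ct (ℓ ∘ inner)) _ ⟩
    reduce (reduce (push s x) (word ct (ℓ ∘ inner))) (complement x ∷ word ts (ℓ ∘ rest))
      ≡⟨ cong (λ s′ → reduce (push s′ (complement x)) (word ts (ℓ ∘ rest)))
              (reduce-word (push s x) ct (ℓ ∘ inner) (push-reduced s x r)) ⟩
    reduce (push (push s x) (complement x)) (word ts (ℓ ∘ rest))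
      ≡⟨ cong (λ s′ → reduce s′ (word ts (ℓ ∘ rest))) (push-push-complement s x r) ⟩
    reduce s (word ts (ℓ ∘ rest))
      ≡⟨ reduce-word s ts (ℓ ∘ rest) r ⟩
    s ∎
    where
    open ≡-Reasoning
    x = ℓ trunk

  reduce-branch : ∀ s {x} → Reduced s → forbidden s ≢ just x → ∀ cs ℓ r →
                reduce s (x ∷ word cs ℓ ++ complement x ∷ r) ≡ reduce s r
  reduce-branch s {x} red fresh cs ℓ r = begin
    reduce (push s x) (word cs ℓ ++ complement x ∷ r)
      ≡⟨ cong (λ s′ → reduce s′ (word cs ℓ ++ complement x ∷ r)) (push-fresh s fresh) ⟩
    reduce (x ∷ s) (word cs ℓ ++ complement x ∷ r)
      ≡⟨ foldl-++ push (x ∷ s) (word cs ℓ) _ ⟩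
    reduce (push (reduce (x ∷ s) (word cs ℓ)) (complement x)) r
      ≡⟨ cong (λ s′ → reduce (push s′ (complement x)) r) (reduce-word (x ∷ s) cs ℓ (fresh , red)) ⟩
    reduce (push (x ∷ s) (complement x)) r
      ≡⟨ cong (λ s′ → reduce s′ r) (push-complement x s) ⟩
    reduce s r ∎
    where open ≡-Reasoning

  reduce-prefix-above : ∀ s cs ℓ → Reduced s → Rainbow complement cs ℓ (forbidden s) →
                  ∀ p {r} → p ++ r ≡ word cs ℓ → Above (trunks cs ℓ) s (reduce s p)
  reduce-prefix-above s cs             ℓ _   _                      []      _  = inj₁ refl
  reduce-prefix-above s (node ct ∷ ts) ℓ red (fresh , _ , rct , rts) (x ∷ p) {r} eq
    with refl , eq′ ← ∷-injective eq
    with ++-prefix-cases p r (word ct (ℓ ∘ inner)) eq′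
  ... | inj₁ (r′ , eqct) =
    subst (λ s′ → Above (trunks (node ct ∷ ts) ℓ) s (reduce s′ p)) (sym (push-fresh s fresh))
      (above-∷ (reduce-prefix-above (x ∷ s) ct (ℓ ∘ inner) (fresh , red) rct p (sym eqct)))
  ... | inj₂ (p′ , refl , eqts) =
    subst (Above (trunks (node ct ∷ ts) ℓ) s) (sym (reduce-branch s red fresh ct (ℓ ∘ inner) p′))
      (above-there (reduce-prefix-above s ts (ℓ ∘ rest) red rts p′ eqts))

  balanced-prefix-next∈trunks : ∀ s cs ℓ → Reduced s → Rainbow complement cs ℓ (forbidden s) →
               ∀ p {y r} → p ++ y ∷ r ≡ word cs ℓ → reduce s p ≡ s → y ∈ trunks cs ℓ
  balanced-prefix-next∈trunks s (node ct ∷ ts) ℓ _   _                      []      eq _ =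
    here (∷-injectiveˡ eq)
  balanced-prefix-next∈trunks s (node ct ∷ ts) ℓ red (fresh , _ , rct , rts) (x ∷ p) {y} {r} eq balanced
    with refl , eq′ ← ∷-injective eq
    with ++-prefix-cases p (y ∷ r) (word ct (ℓ ∘ inner)) eq′
  ... | inj₁ (r′ , eqct) =
    ⊥-elim (above-≢ (reduce-prefix-above (x ∷ s) ct (ℓ ∘ inner) (fresh , red) rct p (sym eqct))
                    (trans (cong (λ s′ → reduce s′ p) (sym (push-fresh s fresh))) balanced))
  ... | inj₂ (p′ , refl , eqts) =
    there (balanced-prefix-next∈trunks s ts (ℓ ∘ rest) red rts p′ eqts
             (trans (sym (reduce-branch s red fresh ct (ℓ ∘ inner) p′)) balanced))

  -- Both words start with the trunk letter x, and the words of the first subtrees must end together: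
  -- if that of cs′ ended first, x̄ would be a trunk letter of ct; if that of cs ended first, the stack
  -- would come back to x ∷ s while reading the word of ts, making x a trunk letter of ts.
  rainbow-word-unique : ∀ s cs ℓ → Reduced s → Rainbow complement cs ℓ (forbidden s) →
                        ∀ cs′ ℓ′ → word cs ℓ ≡ word cs′ ℓ′ → cs ≡ cs′
  rainbow-word-unique s []             ℓ _   _                        []               ℓ′ _  = refl
  rainbow-word-unique s []             ℓ _   _                        (node _ ∷ _)     ℓ′ ()
  rainbow-word-unique s (node _ ∷ _)   ℓ _   _                        []               ℓ′ ()
  rainbow-word-unique s (node ct ∷ ts) ℓ red (fresh , x∉ts , rct , rts) (node ct′ ∷ ts′) ℓ′ eq
    with x≡x′ , eq′ ← ∷-injective eq
    with ++-∷-trichotomy (word ct (ℓ ∘ inner)) (word ct′ (ℓ′ ∘ inner)) eq′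
  ... | inj₁ (eqct , eqts) =
    cong₂ (λ c t → node c ∷ t)
      (rainbow-word-unique (x ∷ s) ct (ℓ ∘ inner) (fresh , red) rct ct′ (ℓ′ ∘ inner) eqct)
      (rainbow-word-unique s ts (ℓ ∘ rest) red rts ts′ (ℓ′ ∘ rest) eqts)
    where x = ℓ trunk
  ... | inj₂ (inj₂ (r , eqct , _)) = ⊥-elim (
    rainbow-trunks ct rct
      (balanced-prefix-next∈trunks (x ∷ s) ct (ℓ ∘ inner) (fresh , red) rct
         (word ct′ (ℓ′ ∘ inner)) (sym eqct) (reduce-word (x ∷ s) ct′ (ℓ′ ∘ inner) (fresh , red)))
      (cong (just ∘ complement) x≡x′))
    where x = ℓ trunk
  ... | inj₂ (inj₁ (r , eqct′ , eqr)) =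
    ⊥-elim (x∉ts (above-head (subst (Above (trunks ts (ℓ ∘ rest)) s) closes
                                     (reduce-prefix-above s ts (ℓ ∘ rest) red rts r eqr))))
    where
    x = ℓ trunk
    open ≡-Reasoning
    closes : reduce s r ≡ x ∷ s
    closes = begin
      reduce s r
        ≡⟨ reduce-branch s red fresh ct (ℓ ∘ inner) r ⟨
      reduce s (x ∷ word ct (ℓ ∘ inner) ++ complement x ∷ r)
        ≡⟨ cong (reduce s ∘ (x ∷_)) eqct′ ⟨
      reduce s (x ∷ word ct′ (ℓ′ ∘ inner))
        ≡⟨ cong (λ s′ → reduce s′ (word ct′ (ℓ′ ∘ inner))) (push-fresh s fresh) ⟩
      reduce (x ∷ s) (word ct′ (ℓ′ ∘ inner))
        ≡⟨ reduce-word (x ∷ s) ct′ (ℓ′ ∘ inner) (fresh , red) ⟩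
      x ∷ s ∎

-- Refolding

module _ {m : ℕ} where

  record TrunkSplitting (cs : List Tree) (ℓ : EdgeF cs → Letter m) (y : Letter m) : Set where
    constructor trunk-splitting
    field
      {front middle back} : List Tree
      ℓf : EdgeF front → Letter m
      ℓm : EdgeF middle → Letter m
      ℓb : EdgeF back → Letter m
      word-split : word cs ℓ ≡ word front ℓf ++ y ∷ word middle ℓm ++ complement y ∷ word back ℓb

  trunk-split : ∀ cs ℓ {y} → y ∈ trunks cs ℓ → TrunkSplitting cs ℓ y
  trunk-split (node ct ∷ ts) ℓ (here refl) =
    trunk-splitting {front = []} (λ ()) (ℓ ∘ inner) (ℓ ∘ rest) refl
  trunk-split (node ct ∷ ts) ℓ (there y∈)
    with trunk-splitting ℓf ℓm ℓb eq ← trunk-split ts (ℓ ∘ rest) y∈ =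
    trunk-splitting (node-labelling (ℓ trunk) (ℓ ∘ inner) ℓf) ℓm ℓb
      (trans (cong (λ u → ℓ trunk ∷ word ct (ℓ ∘ inner) ++ complement (ℓ trunk) ∷ u) eq)
             (cong (ℓ trunk ∷_) (sym (++-assoc (word ct (ℓ ∘ inner)) (complement (ℓ trunk) ∷ word _ ℓf) _))))

  Refoldable : (cs : List Tree) → (EdgeF cs → Letter m) → Set
  Refoldable cs ℓ = ∃[ cs′ ] ∃[ ℓ′ ] cs′ ≢ cs × word cs′ ℓ′ ≡ word cs ℓ

  module _ {ct ts : List Tree} (ℓ : EdgeF (node ct ∷ ts) → Letter m) where

    private
      x = ℓ trunk
      x̄ = complement x
      x̄̄≡x = complement-involutive x
      W = word ct (ℓ ∘ inner)
      R = word ts (ℓ ∘ rest)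

    refoldable-inner : Refoldable ct (ℓ ∘ inner) → Refoldable (node ct ∷ ts) ℓ
    refoldable-inner (ct′ , ℓ′ , ct′≢ct , eq) =
      node ct′ ∷ ts , node-labelling x ℓ′ (ℓ ∘ rest) , ct′≢ct ∘ node-injective ∘ ∷-injectiveˡ ,
      cong (λ v → x ∷ v ++ x̄ ∷ R) eq

    refoldable-rest : Refoldable ts (ℓ ∘ rest) → Refoldable (node ct ∷ ts) ℓ
    refoldable-rest (ts′ , ℓ′ , ts′≢ts , eq) =
      node ct ∷ ts′ , node-labelling x (ℓ ∘ inner) ℓ′ , ts′≢ts ∘ ∷-injectiveʳ ,
      cong (λ v → x ∷ W ++ x̄ ∷ v) eq

    -- x (a x̄ u x b) x̄ r  is refolded as  (x a x̄) u (x b x̄) r.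
    refoldable-backtrack : x̄ ∈ trunks ct (ℓ ∘ inner) → Refoldable (node ct ∷ ts) ℓ
    refoldable-backtrack x̄∈
      with trunk-splitting {front} {middle} {back} ℓf ℓm ℓb eq ← trunk-split ct (ℓ ∘ inner) x̄∈ =
      node front ∷ (middle ++ node back ∷ ts) ,
      node-labelling x ℓf (++-labelling middle ℓm (node-labelling x ℓb (ℓ ∘ rest))) ,
      distinct ,
      cong (x ∷_) (begin
        a ++ x̄ ∷ word (middle ++ node back ∷ ts) _  ≡⟨ cong (λ v → a ++ x̄ ∷ v) (word-++ middle ℓm _) ⟩
        a ++ x̄ ∷ u ++ x ∷ b ++ x̄ ∷ R                ≡⟨ cong (λ z → a ++ x̄ ∷ u ++ z ∷ b ++ x̄ ∷ R) x̄̄≡x ⟨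
        a ++ x̄ ∷ u ++ complement x̄ ∷ b ++ x̄ ∷ R     ≡⟨ ++-∷-++-∷-assoc a u b _ ⟨
        (a ++ x̄ ∷ u ++ complement x̄ ∷ b) ++ x̄ ∷ R   ≡⟨ cong (_++ x̄ ∷ R) eq ⟨
        W ++ x̄ ∷ R                                  ∎)
      where
      open ≡-Reasoning
      a = word front ℓf
      u = word middle ℓm
      b = word back ℓb
      distinct : node front ∷ (middle ++ node back ∷ ts) ≢ node ct ∷ ts
      distinct eq′ with refl ← node-injective (∷-injectiveˡ eq′) =
        length-++-∷-≢ a (trans (cong length (sym eq)) (length-word-labelling ct (ℓ ∘ inner) ℓf))

    -- (x w x̄) a (x u x̄) b  is refolded as  x (w x̄ a x u) x̄ b.
    refoldable-sibling : x ∈ trunks ts (ℓ ∘ rest) → Refoldable (node ct ∷ ts) ℓ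
    refoldable-sibling x∈
      with trunk-splitting {front} {middle} {back} ℓf ℓm ℓb eq ← trunk-split ts (ℓ ∘ rest) x∈ =
      node (ct ++ node front ∷ middle) ∷ back ,
      node-labelling x (++-labelling ct (ℓ ∘ inner) (node-labelling x̄ ℓf ℓm)) ℓb ,
      ++-∷-≢ˡ ct ∘ node-injective ∘ ∷-injectiveˡ ,
      cong (x ∷_) (begin
        word (ct ++ node front ∷ middle) _ ++ x̄ ∷ b  ≡⟨ cong (_++ x̄ ∷ b) (word-++ ct (ℓ ∘ inner) _) ⟩
        (W ++ x̄ ∷ a ++ complement x̄ ∷ u) ++ x̄ ∷ b    ≡⟨ ++-∷-++-∷-assoc W a u _ ⟩
        W ++ x̄ ∷ a ++ complement x̄ ∷ u ++ x̄ ∷ b      ≡⟨ cong (λ z → W ++ x̄ ∷ a ++ z ∷ u ++ x̄ ∷ b) x̄̄≡x ⟩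
        W ++ x̄ ∷ a ++ x ∷ u ++ x̄ ∷ b                 ≡⟨ cong (λ v → W ++ x̄ ∷ v) eq ⟨
        W ++ x̄ ∷ R                                   ∎)
      where
      open ≡-Reasoning
      a = word front ℓf
      u = word middle ℓm
      b = word back ℓb

  open import Data.List.Membership.DecPropositional (_≟_ {m}) using (_∈?_)

  rainbow-or-refoldable : ∀ cs ℓ f →
    Rainbow complement cs ℓ f ⊎ Refoldable cs ℓ ⊎ ∃[ y ] f ≡ just y × y ∈ trunks cs ℓ
  rainbow-or-refoldable []             ℓ f = inj₁ tt
  rainbow-or-refoldable (node ct ∷ ts) ℓ f
    with rainbow-or-refoldable ct (ℓ ∘ inner) (just (complement (ℓ trunk)))
  ... | inj₂ (inj₁ r)               = inj₂ (inj₁ (refoldable-inner ℓ r))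
  ... | inj₂ (inj₂ (_ , refl , x̄∈)) = inj₂ (inj₁ (refoldable-backtrack ℓ x̄∈))
  ... | inj₁ rct with maybe-≡-dec _≟_ f (just (ℓ trunk))
  ...   | yes f≡x  = inj₂ (inj₂ (ℓ trunk , f≡x , here refl))
  ...   | no fresh with ℓ trunk ∈? trunks ts (ℓ ∘ rest)
  ...     | yes x∈ts = inj₂ (inj₁ (refoldable-sibling ℓ x∈ts))
  ...     | no x∉ts with rainbow-or-refoldable ts (ℓ ∘ rest) f
  ...       | inj₁ rts                   = inj₁ (fresh , x∉ts , rct , rts)
  ...       | inj₂ (inj₁ r)              = inj₂ (inj₁ (refoldable-rest ℓ r))
  ...       | inj₂ (inj₂ (y , f≡y , y∈)) = inj₂ (inj₂ (y , f≡y , there y∈))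

-- Proper colourings

Proper : (t : Tree) → (Edge t → A) → Set
Proper t c = ∀ e f → e ≢ f → ShareVertex t e f → c e ≢ c f

AtRoot : (t : Tree) → Edge t → Set
AtRoot t e = upper t e ≡ rootV t

Meet : ∀ {V : Set} → V → V → V → V → Set
Meet u₁ l₁ u₂ l₂ = (u₁ ≡ u₂) ⊎ (u₁ ≡ l₂) ⊎ (l₁ ≡ u₂) ⊎ (l₁ ≡ l₂)

meet-sym : ∀ {V : Set} {u₁ l₁ u₂ l₂ : V} → Meet u₁ l₁ u₂ l₂ → Meet u₂ l₂ u₁ l₁
meet-sym (inj₁ p)               = inj₁ (sym p)
meet-sym (inj₂ (inj₁ p))        = inj₂ (inj₂ (inj₁ (sym p)))
meet-sym (inj₂ (inj₂ (inj₁ p))) = inj₂ (inj₁ (sym p))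
meet-sym (inj₂ (inj₂ (inj₂ p))) = inj₂ (inj₂ (inj₂ (sym p)))

module _ {V W : Set} (g : V → W) {u₁ l₁ u₂ l₂ : V} where

  meet-map : Meet u₁ l₁ u₂ l₂ → Meet (g u₁) (g l₁) (g u₂) (g l₂)
  meet-map = Sum.map (cong g) (Sum.map (cong g) (Sum.map (cong g) (cong g)))

  meet-map⁻ : (∀ {x y} → g x ≡ g y → x ≡ y) →
              Meet (g u₁) (g l₁) (g u₂) (g l₂) → Meet u₁ l₁ u₂ l₂
  meet-map⁻ inj = Sum.map inj (Sum.map inj (Sum.map inj inj))

shiftV-root : ∀ {t ts} (v : Vertex (node ts)) → shiftV {t} v ≡ rootV (node (t ∷ ts)) → v ≡ rootV (node ts)
shiftV-root (inj₁ tt) _ = refl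

lower-not-root : ∀ cs e → lower (node cs) e ≢ rootV (node cs)
lower-not-root (node ct ∷ ts) trunk     ()
lower-not-root (node ct ∷ ts) (inner e) ()
lower-not-root (node ct ∷ ts) (rest e)  eq = lower-not-root ts e (shiftV-root (lowerF ts e) eq)

module _ {ct ts : List Tree} where

  private
    T = node (node ct ∷ ts)

    into-inner : Vertex (node ct) → Vertex T
    into-inner = inj₂ ∘ inj₁

    into-inner-injective : ∀ {v w} → into-inner v ≡ into-inner w → v ≡ w
    into-inner-injective refl = refl

    shiftV-injective : ∀ {v w : Vertex (node ts)} → shiftV {node ct} v ≡ shiftV w → v ≡ w
    shiftV-injective {inj₁ tt} {inj₁ tt} _    = refl
    shiftV-injective {inj₂ _}  {inj₂ _}  refl = refl

    shiftV-≢-inner : ∀ (v : Vertex (node ts)) {w} → shiftV {node ct} v ≢ into-inner w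
    shiftV-≢-inner (inj₁ _) ()
    shiftV-≢-inner (inj₂ _) ()

  proper-inner : ∀ {c : Edge T → A} → Proper T c → Proper (node ct) (c ∘ inner)
  proper-inner pr e f e≢f sh = pr (inner e) (inner f) (e≢f ∘ inner-injective) (meet-map into-inner sh)

  proper-rest : ∀ {c : Edge T → A} → Proper T c → Proper (node ts) (c ∘ rest)
  proper-rest pr e f e≢f sh = pr (rest e) (rest f) (e≢f ∘ rest-injective) (meet-map shiftV sh)

  share-inner⁻ : ∀ {e f} → ShareVertex T (inner e) (inner f) → ShareVertex (node ct) e f
  share-inner⁻ = meet-map⁻ into-inner into-inner-injective

  share-rest⁻ : ∀ {e f} → ShareVertex T (rest e) (rest f) → ShareVertex (node ts) e f
  share-rest⁻ = meet-map⁻ shiftV shiftV-injective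

  share-trunk-inner : ∀ {f} → AtRoot (node ct) f → ShareVertex T trunk (inner f)
  share-trunk-inner at = inj₂ (inj₂ (inj₁ (cong into-inner (sym at))))

  share-trunk-inner⁻ : ∀ {f} → ShareVertex T trunk (inner f) → AtRoot (node ct) f
  share-trunk-inner⁻ (inj₂ (inj₂ (inj₁ p)))     = sym (into-inner-injective p)
  share-trunk-inner⁻ {f} (inj₂ (inj₂ (inj₂ p))) =
    ⊥-elim (lower-not-root ct f (sym (into-inner-injective p)))

  share-trunk-rest : ∀ {f} → AtRoot (node ts) f → ShareVertex T trunk (rest f)
  share-trunk-rest at = inj₁ (cong shiftV (sym at))

  share-trunk-rest⁻ : ∀ {f} → ShareVertex T trunk (rest f) → AtRoot (node ts) f
  share-trunk-rest⁻ {f} (inj₁ p)                 = shiftV-root (upperF ts f) (sym p)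
  share-trunk-rest⁻ {f} (inj₂ (inj₁ p))          =
    ⊥-elim (lower-not-root ts f (shiftV-root (lowerF ts f) (sym p)))
  share-trunk-rest⁻ {f} (inj₂ (inj₂ (inj₁ p)))   = ⊥-elim (shiftV-≢-inner (upperF ts f) (sym p))
  share-trunk-rest⁻ {f} (inj₂ (inj₂ (inj₂ p)))   = ⊥-elim (shiftV-≢-inner (lowerF ts f) (sym p))

  ¬share-inner-rest : ∀ {e f} → ¬ ShareVertex T (inner e) (rest f)
  ¬share-inner-rest {f = f} (inj₁ p)               = shiftV-≢-inner (upperF ts f) (sym p)
  ¬share-inner-rest {f = f} (inj₂ (inj₁ p))        = shiftV-≢-inner (lowerF ts f) (sym p)
  ¬share-inner-rest {f = f} (inj₂ (inj₂ (inj₁ p))) = shiftV-≢-inner (upperF ts f) (sym p)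
  ¬share-inner-rest {f = f} (inj₂ (inj₂ (inj₂ p))) = shiftV-≢-inner (lowerF ts f) (sym p)

atRoot-∈ : ∀ cs {c : EdgeF cs → A} e → AtRoot (node cs) e → c e ∈ trunks cs c
atRoot-∈ (node ct ∷ ts) trunk    _  = here refl
atRoot-∈ (node ct ∷ ts) (rest e) at = there (atRoot-∈ ts e (shiftV-root (upperF ts e) at))

∈-atRoot : ∀ cs {c : EdgeF cs → A} {y} → y ∈ trunks cs c → ∃[ e ] AtRoot (node cs) e × c e ≡ y
∈-atRoot (node ct ∷ ts) (here refl) = trunk , refl , refl
∈-atRoot (node ct ∷ ts) (there y∈) with e , at , eq ← ∈-atRoot ts y∈ = rest e , cong shiftV at , eq

rainbow⇒proper : ∀ cs {c : EdgeF cs → A} {f} → Rainbow id cs c f → Proper (node cs) c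
rainbow⇒proper (node ct ∷ ts) {c} (_ , c∉ts , rct , rts) = proper
  where
  trunk-inner : ∀ {g} → AtRoot (node ct) g → c trunk ≢ c (inner g)
  trunk-inner {g} at eq = rainbow-trunks ct rct (atRoot-∈ ct g at) (cong just eq)

  trunk-rest : ∀ {g} → AtRoot (node ts) g → c trunk ≢ c (rest g)
  trunk-rest {g} at eq = c∉ts (subst (_∈ trunks ts (c ∘ rest)) (sym eq) (atRoot-∈ ts g at))

  proper : Proper (node (node ct ∷ ts)) c
  proper trunk     trunk     e≢f _  = ⊥-elim (e≢f refl)
  proper trunk     (inner g) _   sh = trunk-inner (share-trunk-inner⁻ sh)
  proper trunk     (rest g)  _   sh = trunk-rest (share-trunk-rest⁻ sh)
  proper (inner g) trunk     _   sh = trunk-inner (share-trunk-inner⁻ (meet-sym sh)) ∘ sym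
  proper (rest g)  trunk     _   sh = trunk-rest (share-trunk-rest⁻ (meet-sym sh)) ∘ sym
  proper (inner g) (inner h) e≢f sh = rainbow⇒proper ct rct g h (e≢f ∘ cong inner) (share-inner⁻ sh)
  proper (rest g)  (rest h)  e≢f sh = rainbow⇒proper ts rts g h (e≢f ∘ cong rest) (share-rest⁻ sh)
  proper (inner g) (rest h)  _   sh = ⊥-elim (¬share-inner-rest sh)
  proper (rest g)  (inner h) _   sh = ⊥-elim (¬share-inner-rest (meet-sym sh))

proper⇒rainbow : ∀ cs {c : EdgeF cs → A} {f} → Proper (node cs) c →
                 (∀ e → AtRoot (node cs) e → f ≢ just (c e)) → Rainbow id cs c f
proper⇒rainbow []             _  _     = tt
proper⇒rainbow (node ct ∷ ts) pr fresh =
    fresh trunk refl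
  , (λ x∈ → let e , at , eq = ∈-atRoot ts x∈ in pr trunk (rest e) (λ ()) (share-trunk-rest at) (sym eq))
  , proper⇒rainbow ct (proper-inner pr)
      (λ e at eq → pr trunk (inner e) (λ ()) (share-trunk-inner at) (just-injective eq))
  , proper⇒rainbow ts (proper-rest pr) (λ e at → fresh (rest e) (cong shiftV at))

proper-cong : ∀ {t} {c c′ : Edge t → A} → (∀ e → c e ≡ c′ e) → Proper t c → Proper t c′
proper-cong h pr e f e≢f sh c′e≡c′f = pr e f e≢f sh (trans (h e) (trans c′e≡c′f (sym (h f))))

-- Colourings of rainbow labellings

transpose-sends : ∀ {k} (i j : Fin k) → PC.transpose i j i ≡ j
transpose-sends i j rewrite dec-true (i Fin.≟ i) refl = refl

Colour : ℕ → Set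
Colour m = Fin (2 * m)

module _ {m : ℕ} where

  letter↔colour : Letter m ↔ Colour m
  letter↔colour = ↔-sym (↔-trans *↔× (↔-trans (×-cong 2↔Bool ↔-refl) (×-comm Bool (Fin m))))

  reorient : Letter m ↔ Colour m → Letter m → Letter m ↔ Colour m
  reorient σ x = ↔-trans σ (transpose (to σ (complement x)) (to σ x))

  reorient-complement : ∀ σ x → to (reorient σ x) (complement x) ≡ to σ x
  reorient-complement σ x = transpose-sends (to σ (complement x)) (to σ x)

  colouring : ∀ cs → (EdgeF cs → Letter m) → Letter m ↔ Colour m → EdgeF cs → Colour m
  colouring (node ct ∷ ts) ℓ σ trunk     = to σ (ℓ trunk)
  colouring (node ct ∷ ts) ℓ σ (inner e) = colouring ct (ℓ ∘ inner) (reorient σ (ℓ trunk)) e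
  colouring (node ct ∷ ts) ℓ σ (rest e)  = colouring ts (ℓ ∘ rest) σ e

  labelling : ∀ cs → (EdgeF cs → Colour m) → Letter m ↔ Colour m → EdgeF cs → Letter m
  labelling (node ct ∷ ts) c σ trunk     = from σ (c trunk)
  labelling (node ct ∷ ts) c σ (inner e) = labelling ct (c ∘ inner) (reorient σ (from σ (c trunk))) e
  labelling (node ct ∷ ts) c σ (rest e)  = labelling ts (c ∘ rest) σ e

  labelling-colouring : ∀ cs ℓ σ e → labelling cs (colouring cs ℓ σ) σ e ≡ ℓ e
  labelling-colouring (node ct ∷ ts) ℓ σ trunk     = strictlyInverseʳ σ (ℓ trunk)
  labelling-colouring (node ct ∷ ts) ℓ σ (inner e)
    rewrite strictlyInverseʳ σ (ℓ trunk) = labelling-colouring ct (ℓ ∘ inner) (reorient σ (ℓ trunk)) e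
  labelling-colouring (node ct ∷ ts) ℓ σ (rest e)  = labelling-colouring ts (ℓ ∘ rest) σ e

  colouring-labelling : ∀ cs c σ e → colouring cs (labelling cs c σ) σ e ≡ c e
  colouring-labelling (node ct ∷ ts) c σ trunk     = strictlyInverseˡ σ (c trunk)
  colouring-labelling (node ct ∷ ts) c σ (inner e) =
    colouring-labelling ct (c ∘ inner) (reorient σ (from σ (c trunk))) e
  colouring-labelling (node ct ∷ ts) c σ (rest e)  = colouring-labelling ts (c ∘ rest) σ e

  colouring-cong : ∀ cs {ℓ ℓ′} σ → (∀ e → ℓ e ≡ ℓ′ e) →
                   ∀ e → colouring cs ℓ σ e ≡ colouring cs ℓ′ σ e
  colouring-cong (node ct ∷ ts) σ h trunk     = cong (to σ) (h trunk)
  colouring-cong (node ct ∷ ts) {ℓ} σ h (inner e)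
    rewrite h trunk = colouring-cong ct (reorient σ _) (h ∘ inner) e
  colouring-cong (node ct ∷ ts) σ h (rest e)  = colouring-cong ts σ (h ∘ rest) e

  trunks-colouring : ∀ cs ℓ σ → trunks cs (colouring cs ℓ σ) ≡ map (to σ) (trunks cs ℓ)
  trunks-colouring []             ℓ σ = refl
  trunks-colouring (node ct ∷ ts) ℓ σ = cong (to σ (ℓ trunk) ∷_) (trunks-colouring ts (ℓ ∘ rest) σ)

  rainbow-colouring : ∀ cs ℓ σ {f f′} → Maybe.map (to σ) f ≡ f′ →
                      Rainbow complement cs ℓ f → Rainbow id cs (colouring cs ℓ σ) f′
  rainbow-colouring []             ℓ σ _    _                        = tt
  rainbow-colouring (node ct ∷ ts) ℓ σ refl (fresh , x∉ts , rct , rts) =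
      map-≢-just (to-injective σ) fresh
    , x∉ts ∘ ∈-map-injective (to-injective σ) ∘ subst (_ ∈_) (trunks-colouring ts (ℓ ∘ rest) σ)
    , rainbow-colouring ct (ℓ ∘ inner) (reorient σ (ℓ trunk))
        (cong just (reorient-complement σ (ℓ trunk))) rct
    , rainbow-colouring ts (ℓ ∘ rest) σ refl rts

  rainbow-colouring⁻ : ∀ cs ℓ σ {f f′} → Maybe.map (to σ) f ≡ f′ →
                       Rainbow id cs (colouring cs ℓ σ) f′ → Rainbow complement cs ℓ f
  rainbow-colouring⁻ []             ℓ σ _    _                        = tt
  rainbow-colouring⁻ (node ct ∷ ts) ℓ σ refl (fresh , c∉ts , rct , rts) =
      fresh ∘ cong (Maybe.map (to σ))
    , c∉ts ∘ subst (_ ∈_) (sym (trunks-colouring ts (ℓ ∘ rest) σ)) ∘ ∈-map⁺ (to σ)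
    , rainbow-colouring⁻ ct (ℓ ∘ inner) (reorient σ (ℓ trunk))
        (cong just (reorient-complement σ (ℓ trunk))) rct
    , rainbow-colouring⁻ ts (ℓ ∘ rest) σ refl rts

module _ {n m : ℕ} where

  word-vector : ∀ cs (ℓ : EdgeF cs → Letter m) → numEdgesF cs ≡ n → Vec (Letter m) (2 * n)
  word-vector cs ℓ edges = Vec.cast (trans (length-word cs ℓ) (cong (2 *_) edges)) (Vec.fromList (word cs ℓ))

  toList-word-vector : ∀ cs ℓ edges → toList (word-vector cs ℓ edges) ≡ word cs ℓ
  toList-word-vector cs ℓ edges =
    trans (toList-cast _ (Vec.fromList (word cs ℓ))) (toList∘fromList (word cs ℓ))

  record RainbowFolding (w : Vec (Letter m) (2 * n)) : Set where
    constructor rainbow-folding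
    field
      forest  : List Tree
      labels  : EdgeF forest → Letter m
      edges   : numEdgesF forest ≡ n
      spells  : toList w ≡ word forest labels
      rainbow : Rainbow complement forest labels nothing

  foldable-one : ∀ {w : Vec (Letter m) (2 * n)} T → WValid n w T → (∀ T′ → WValid n w T′ → T ≡ T′) →
                 Foldable n 1 w
  foldable-one T valid unique =
    T Vec.∷ Vec.[] , (λ { Fin.zero Fin.zero _ → refl }) , (λ { Fin.zero → valid }) ,
    λ T′ valid′ → Fin.zero , unique T′ valid′

  rainbow-folding⇒foldable : ∀ {w} → RainbowFolding w → Foldable n 1 w
  rainbow-folding⇒foldable {w} (rainbow-folding cs ℓ edges spells rainbow) =
    foldable-one (node cs) (word⇒valid w cs ℓ edges spells) unique
    where
    unique : ∀ T′ → WValid n w T′ → node cs ≡ T′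
    unique (node cs′) valid′ with ℓ′ , spells′ ← valid⇒word w cs′ valid′ =
      cong node (rainbow-word-unique [] cs ℓ tt rainbow cs′ ℓ′ (trans (sym spells) spells′))

  foldable⇒rainbow-folding : ∀ {w} → Foldable n 1 w → RainbowFolding w
  foldable⇒rainbow-folding {w} (Ts , _ , valid , unique) =
    of-tree (Vec.lookup Ts Fin.zero) (valid Fin.zero) unique-lookup
    where
    unique-lookup : ∀ T′ → WValid n w T′ → Vec.lookup Ts Fin.zero ≡ T′
    unique-lookup T′ valid′ with Fin.zero , eq ← unique T′ valid′ = eq

    of-tree : ∀ T → WValid n w T → (∀ T′ → WValid n w T′ → T ≡ T′) → RainbowFolding w
    of-tree (node cs) valid@(edges , _) unique = rainbow-folding cs ℓ edges spells rainbow
      where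
      ℓ = proj₁ (valid⇒word w cs valid)
      spells = proj₂ (valid⇒word w cs valid)

      rainbow : Rainbow complement cs ℓ nothing
      rainbow with rainbow-or-refoldable cs ℓ nothing
      ... | inj₁ r                            = r
      ... | inj₂ (inj₂ (_ , () , _))
      ... | inj₂ (inj₁ (cs′ , ℓ′ , cs′≢cs , eq)) =
        ⊥-elim (cs′≢cs (node-injective (sym (unique (node cs′) valid′))))
        where valid′ = word⇒valid w cs′ ℓ′ (trans (numEdges-word eq) edges) (trans spells (sym eq))

  colour-folding : ∀ {w} → RainbowFolding w → ColoredTree n m
  colour-folding (rainbow-folding cs ℓ edges _ rainbow) =
    ctree (node cs) edges (colouring cs ℓ letter↔colour)
      (rainbow⇒proper cs (rainbow-colouring cs ℓ letter↔colour refl rainbow))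

  coloured-tree : FoldWord n m → ColoredTree n m
  coloured-tree (fword _ foldable) = colour-folding (foldable⇒rainbow-folding foldable)

  fold-word : ColoredTree n m → FoldWord n m
  fold-word (ctree (node cs) edges c proper) =
    fword (word-vector cs ℓ edges)
          (rainbow-folding⇒foldable (rainbow-folding cs ℓ edges (toList-word-vector cs ℓ edges) rainbow))
    where
    ℓ = labelling cs c letter↔colour
    rainbow : Rainbow complement cs ℓ nothing
    rainbow = rainbow-colouring⁻ cs ℓ letter↔colour refl
      (proper⇒rainbow cs (proper-cong (sym ∘ colouring-labelling cs c letter↔colour) proper) (λ _ _ ()))

  fold-word∘coloured-tree : ∀ x → fold-word (coloured-tree x) ≈W x
  fold-word∘coloured-tree (fword w foldable) =
    toList-injective-≡ _ w (begin
      toList (word-vector cs (labelling cs (colouring cs ℓ letter↔colour) letter↔colour) edges)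
        ≡⟨ toList-word-vector cs _ edges ⟩
      word cs (labelling cs (colouring cs ℓ letter↔colour) letter↔colour)
        ≡⟨ word-cong cs (labelling-colouring cs ℓ letter↔colour) ⟩
      word cs ℓ
        ≡⟨ spells ⟨
      toList w ∎)
    where
    open ≡-Reasoning
    open RainbowFolding (foldable⇒rainbow-folding foldable) renaming (forest to cs; labels to ℓ)

  coloured-tree∘fold-word : ∀ y → coloured-tree (fold-word y) ≈C y
  coloured-tree∘fold-word (ctree (node cs) edges c proper) =
    refl , λ e → trans (colouring-cong cs letter↔colour same-labels e) (colouring-labelling cs c letter↔colour e)
    where
    folding = foldable⇒rainbow-folding (FoldWord.foldable (fold-word (ctree (node cs) edges c proper)))
    same-labels : ∀ e → RainbowFolding.labels folding e ≡ labelling cs c letter↔colour e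
    same-labels = word-injective cs (trans (sym (RainbowFolding.spells folding)) (toList-word-vector cs _ edges))

-- The correspondence holds for all n and m.
mainTheorem4 : (n m : ℕ) → n ≥ 1 → m ≥ 1 → Bijection n m
mainTheorem4 n m _ _ = coloured-tree , fold-word , fold-word∘coloured-tree , coloured-tree∘fold-word
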